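{- For every integer $n\ge1$, \[2^{\binom n2}=\sum_{\alpha\in Y_n^+(\{r,b,g,y\})}\prod_{1\le i\le k\le n-1}\binom{C_{i+1,k}(\alpha)}{E_{i,k}(\alpha)}.\]
   Context: $Y_n^+(\{r,b,g,y\})$ is the set of integer arrays $\alpha=(\alpha_{i,j})$ indexed by $1\le i\le n$, $0\le j\le n-i$, such that $\alpha_{i,0}=i$, $i\le\alpha_{i,j}\le i+j$ for all entries, and, whenever both entries involved are defined, $\alpha_{i,j}\le\alpha_{i-1,j+1}+1$, $\alpha_{i,j}\le\alpha_{i+1,j-1}$ and $\alpha_{i,j}\le\alpha_{i,j+1}$. For $j\ge1$ the southwest neighbor of $\alpha_{i,j}$ is $\alpha_{i+1,j-1}$. $E_{i,k}(\alpha)$ is the number of entries $\alpha_{i,j}$ with $j\ge1$ in row $i$ having value $k$ and equal to their southwest neighbor; $C_{i,k}(\alpha)$ is the number of entries in row $i$ (including column $0$) with value $k$. -}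

module Defs where

open import Data.Nat using (ℕ; zero; suc; _+_; _∸_; _≤_; _<_)
open import Data.Nat.Combinatorics using (_C_)
open import Data.Bool using (Bool; true; false; _∧_; if_then_else_)
open import Data.List using (List; []; _∷_; length; map; filterᵇ; upTo; concatMap; lookup)
open import Data.Nat.ListAction using (product)
open import Data.Maybe using (Maybe; just; nothing)
open import Data.Nat using (_≡ᵇ_)
open import Data.Fin using (Fin; toℕ)
open import Data.Product using (_×_)
open import Relation.Binary.PropositionalEquality using (_≡_)

-- An array α = (α_{i,j}) is stored as a list of rows; the list element at
-- (0-based) position p is row i = p + 1, and the element at position j of
-- that row is α_{i,j}.
Array : Set
Array = List (List ℕ)

nth : {A : Set} → List A → ℕ → Maybe A
nth []       _       = nothing
nth (x ∷ _)  zero    = just x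
nth (_ ∷ xs) (suc k) = nth xs k

-- at α i j = α_{i,j} (1-based row index i, 0-based column index j),
-- or nothing if that entry is not defined
at : Array → ℕ → ℕ → Maybe ℕ
at α zero    j = nothing
at α (suc p) j with nth α p
... | nothing = nothing
... | just r  = nth r j

-- The triangular shape: rows i = 1..n, row i has entries j = 0..n-i.
Shape : ℕ → Array → Set
Shape n α = (length α ≡ n) × ((p : Fin (length α)) → length (lookup α p) ≡ n ∸ toℕ p)

record InY (n : ℕ) (α : Array) : Set where
  field
    shape   : Shape n α
    col0    : ∀ i v → at α i 0 ≡ just v → v ≡ i
    lower   : ∀ i j v → at α i j ≡ just v → i ≤ v
    upper   : ∀ i j v → at α i j ≡ just v → v ≤ i + j
    condNE  : ∀ i j v w → at α (suc i) j ≡ just v → at α i (suc j) ≡ just w → v ≤ suc w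
    condSW  : ∀ i j v w → at α i (suc j) ≡ just v → at α (suc i) j ≡ just w → v ≤ w
    condE   : ∀ i j v w → at α i j ≡ just v → at α i (suc j) ≡ just w → v ≤ w

is : Maybe ℕ → ℕ → Bool
is nothing  k = false
is (just v) k = v ≡ᵇ k

-- C_{i,k}(α): number of entries α_{i,j} (j ≥ 0) with value k
-- (row i has at most n entries, so j ranges over 0..n)
Cnt : ℕ → Array → ℕ → ℕ → ℕ
Cnt n α i k = length (filterᵇ (λ j → is (at α i j) k) (upTo (suc n)))

Ecnt : ℕ → Array → ℕ → ℕ → ℕ
Ecnt n α i k =
  length (filterᵇ (λ j → is (at α i (suc j)) k ∧ is (at α (suc i) j) k) (upTo (suc n)))

range : ℕ → ℕ → List ℕ
range a b = map (a +_) (upTo (suc b ∸ a))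

weight : ℕ → Array → ℕ
weight n α =
  product (concatMap (λ i → map (λ k → Cnt n α (suc i) k C Ecnt n α i k)
                                (range i (n ∸ 1)))
                     (range 1 (n ∸ 1)))

-- Deleting the first row of α ∈ Y_{n+1} and lowering every other entry by one gives β ∈ Y_n, and
-- conversely the first rows (1, s₁, …, sₙ) over β are those with sⱼ ∈ {cⱼ, cⱼ + 1} weakly increasing,
-- where c is the first row of β. The weight of α is the weight of β times the factors of row 1, and
-- these depend only on c and s: over a maximal block of M equal entries x of c, s must be l copies of x
-- followed by M − l copies of x + 1, contributing binom(M, M − l). Summing over l gives 2^M per
-- block, so the row-1 factors of all α over β sum to 2^n. Hence the total weight grows by the factor
-- 2^n from Y_n to Y_{n+1}, and 2^n · 2^(n C 2) = 2^((n + 1) C 2).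

module Submission where

open import Defs
open import Data.Nat using (ℕ; zero; suc; pred; _+_; _*_; _^_; _∸_; _≤_; _<_; _≤ᵇ_; _≡ᵇ_; z≤n; s≤s)
open import Data.Nat.Properties
open import Data.Nat.Combinatorics using (_C_; k>n⇒nCk≡0; nCk≡nC[n∸k]; nCk+nC[k+1]≡[n+1]C[k+1]; nC1≡n)
open import Data.Nat.ListAction using (sum; product)
open import Data.Nat.ListAction.Properties using (sum-++; sum-↭; product-++)
open import Data.List using (List; []; _∷_; map; _++_; length; concatMap; replicate; upTo; applyUpTo; lookup; filterᵇ)
open import Data.List.Properties
  using (map-++; map-cong; map-∘; ∷-injective; ++-assoc; length-++; length-replicate; map-replicate;
         length-map; map-injective; map-applyUpTo; concatMap-map; concatMap-cong)
open import Data.List.Membership.Propositional using (_∈_; find; lose)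
open import Data.List.Membership.Propositional.Properties
  using (∈-map⁺; ∈-map⁻; ∈-++⁺ˡ; ∈-++⁺ʳ; ∈-++⁻; ∈-concatMap⁺; ∈-concatMap⁻; ∈-upTo⁺)
open import Data.List.Membership.Propositional.Properties.WithK using (unique∧set⇒bag)
open import Data.List.Relation.Binary.BagAndSetEquality using (∼bag⇒↭)
import Data.List.Relation.Binary.Permutation.Propositional.Properties as Perm
open import Data.List.Relation.Unary.Any using (here; there)
import Data.List.Relation.Unary.All as All
open import Data.List.Relation.Unary.All.Properties using (map⁺)
open import Data.List.Relation.Unary.AllPairs using ([]; _∷_)
open import Data.List.Relation.Unary.Linked using (Linked; []; [-]; _∷_)
open import Data.List.Relation.Unary.Linked.Properties using (Linked⇒All)
open import Data.List.Relation.Unary.Unique.Propositional using (Unique)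
import Data.List.Relation.Unary.Unique.Propositional.Properties as Unique
open import Data.Product using (∃; ∃₂; _×_; _,_; proj₁; proj₂)
open import Data.Maybe using (just; nothing; _>>=_)
import Data.Maybe as Maybe
open import Data.Maybe.Properties using (just-injective)
open import Data.Fin using (Fin; toℕ) renaming (zero to fzero; suc to fsuc)
open import Data.Empty using (⊥; ⊥-elim)
open import Data.Bool using (Bool; true; false; T; _∧_; if_then_else_)
open import Data.Bool.Properties using (T-≡)
open import Data.Sum using (_⊎_; inj₁; inj₂)
open import Relation.Nullary using (¬_; yes; no)
open import Function using (_∘_)
open import Function.Bundles using (_⇔_; mk⇔; Equivalence)
open import Relation.Binary.PropositionalEquality
open import Data.Nat.Solver using (module +-*-Solver)
open +-*-Solver using (solve; _:+_; _:*_; _:=_; con)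

-- Sums and products over lists and initial segments of ℕ

sum-map-++ : ∀ {A : Set} (f : A → ℕ) xs ys →
  sum (map f (xs ++ ys)) ≡ sum (map f xs) + sum (map f ys)
sum-map-++ f xs ys = trans (cong sum (map-++ f xs ys)) (sum-++ (map f xs) (map f ys))

sum-map-map : ∀ {A B : Set} (F : B → ℕ) (g : A → B) xs →
  sum (map F (map g xs)) ≡ sum (map (λ a → F (g a)) xs)
sum-map-map F g xs = cong sum (sym (map-∘ xs))

sum-concatMap : ∀ {A B : Set} (f : B → ℕ) (g : A → List B) xs →
  sum (map f (concatMap g xs)) ≡ sum (map (λ x → sum (map f (g x))) xs)
sum-concatMap f g []       = refl
sum-concatMap f g (x ∷ xs) =
  trans (sum-map-++ f (g x) (concatMap g xs)) (cong (sum (map f (g x)) +_) (sum-concatMap f g xs))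

sum-map-cong-∈ : ∀ {A : Set} {f g : A → ℕ} xs → (∀ {a} → a ∈ xs → f a ≡ g a) →
  sum (map f xs) ≡ sum (map g xs)
sum-map-cong-∈ []       f≡g = refl
sum-map-cong-∈ (x ∷ xs) f≡g =
  cong₂ _+_ (f≡g (here refl)) (sum-map-cong-∈ xs (λ a∈xs → f≡g (there a∈xs)))

sum-map-*ˡ : ∀ {A : Set} (f : A → ℕ) a xs → sum (map (λ x → a * f x) xs) ≡ a * sum (map f xs)
sum-map-*ˡ f a []       = sym (*-zeroʳ a)
sum-map-*ˡ f a (x ∷ xs) = trans (cong (a * f x +_) (sum-map-*ˡ f a xs)) (sym (*-distribˡ-+ a (f x) _))

sum-map-*ʳ : ∀ {A : Set} (f : A → ℕ) a xs → sum (map (λ x → f x * a) xs) ≡ sum (map f xs) * a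
sum-map-*ʳ f a []       = refl
sum-map-*ʳ f a (x ∷ xs) = trans (cong (f x * a +_) (sum-map-*ʳ f a xs)) (sym (*-distribʳ-+ a (f x) _))

sum-map-unique : ∀ {A : Set} (f : A → ℕ) {xs ys} → Unique xs → Unique ys →
  (∀ a → a ∈ xs ⇔ a ∈ ys) → sum (map f xs) ≡ sum (map f ys)
sum-map-unique f uxs uys xs⇔ys =
  sum-↭ (Perm.map⁺ f (∼bag⇒↭ (unique∧set⇒bag uxs uys (λ {a} → xs⇔ys a))))

product-map-* : ∀ {A : Set} (f g : A → ℕ) xs →
  product (map (λ x → f x * g x) xs) ≡ product (map f xs) * product (map g xs)
product-map-* f g []       = refl
product-map-* f g (x ∷ xs) = trans (cong (f x * g x *_) (product-map-* f g xs))
  (solve 4 (λ a b c d → a :* b :* (c :* d) := a :* c :* (b :* d)) refl (f x) (g x) _ _)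

∑< : ℕ → (ℕ → ℕ) → ℕ
∑< zero    f = 0
∑< (suc t) f = f 0 + ∑< t (λ l → f (suc l))

syntax ∑< t (λ l → e) = ∑[ l < t ] e

∑-cong : ∀ {f g} t → (∀ {l} → l < t → f l ≡ g l) → ∑< t f ≡ ∑< t g
∑-cong zero    f≡g = refl
∑-cong (suc t) f≡g = cong₂ _+_ (f≡g (s≤s z≤n)) (∑-cong t (λ l<t → f≡g (s≤s l<t)))

∑-last : ∀ f t → ∑< (suc t) f ≡ ∑< t f + f t
∑-last f zero    = +-identityʳ (f 0)
∑-last f (suc t) = trans (cong (f 0 +_) (∑-last (λ l → f (suc l)) t)) (sym (+-assoc (f 0) _ _))

∑-+ : ∀ f g t → ∑[ l < t ] (f l + g l) ≡ ∑< t f + ∑< t g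
∑-+ f g zero    = refl
∑-+ f g (suc t) = trans (cong (f 0 + g 0 +_) (∑-+ (λ l → f (suc l)) (λ l → g (suc l)) t))
  (solve 4 (λ a b c d → (a :+ b) :+ (c :+ d) := (a :+ c) :+ (b :+ d)) refl (f 0) (g 0) _ _)

∑-*ʳ : ∀ f a t → ∑[ l < t ] (f l * a) ≡ ∑< t f * a
∑-*ʳ f a zero    = refl
∑-*ʳ f a (suc t) = trans (cong (f 0 * a +_) (∑-*ʳ (λ l → f (suc l)) a t)) (sym (*-distribʳ-+ a (f 0) _))

∑-binomial : ∀ M → ∑[ l < suc M ] (M C l) ≡ 2 ^ M
∑-binomial zero    = refl
∑-binomial (suc M) = begin
  1 + ∑[ l < suc M ] (suc M C suc l)
    ≡⟨ cong (1 +_) (∑-cong (suc M) (λ {l} _ → sym (nCk+nC[k+1]≡[n+1]C[k+1] M l))) ⟩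
  1 + ∑[ l < suc M ] (M C l + M C suc l)
    ≡⟨ cong (1 +_) (∑-+ (M C_) (λ l → M C suc l) (suc M)) ⟩
  1 + (S + S⁺)
    ≡⟨ solve 2 (λ S S⁺ → con 1 :+ (S :+ S⁺) := S :+ (con 1 :+ S⁺)) refl S S⁺ ⟩
  S + (1 + S⁺)
    ≡⟨ cong (S +_) S≡1+S⁺ ⟨
  S + S
    ≡⟨ cong₂ _+_ (∑-binomial M) (trans (∑-binomial M) (sym (+-identityʳ (2 ^ M)))) ⟩
  2 ^ suc M ∎
  where
  open ≡-Reasoning
  S S⁺ : ℕ
  S  = ∑[ l < suc M ] (M C l)
  S⁺ = ∑[ l < suc M ] (M C suc l)
  -- the extra term M C (M + 1) of the shifted sum vanishes
  S≡1+S⁺ : S ≡ 1 + S⁺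
  S≡1+S⁺ = begin
    S                                 ≡⟨ +-identityʳ S ⟨
    S + 0                             ≡⟨ cong (S +_) (k>n⇒nCk≡0 (≤-refl {suc M})) ⟨
    S + M C suc M                     ≡⟨ ∑-last (M C_) (suc M) ⟨
    1 + S⁺                            ∎

∑-binomial-reversed : ∀ M → ∑[ l < suc M ] (M C (M ∸ l)) ≡ 2 ^ M
∑-binomial-reversed M =
  trans (∑-cong (suc M) (λ l<1+M → sym (nCk≡nC[n∸k] (≤-pred l<1+M)))) (∑-binomial M)

-- Counting entries and the factors of one row

T⇒≡true : ∀ {b} → T b → b ≡ true
T⇒≡true = Equivalence.to T-≡

¬T⇒≡false : ∀ {b} → ¬ T b → b ≡ false
¬T⇒≡false {true}  ¬t = ⊥-elim (¬t _)
¬T⇒≡false {false} _  = refl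

≡ᵇ-refl : ∀ x → (x ≡ᵇ x) ≡ true
≡ᵇ-refl x = T⇒≡true (≡⇒≡ᵇ x x refl)

≢⇒≡ᵇ≡false : ∀ {m n} → m ≢ n → (m ≡ᵇ n) ≡ false
≢⇒≡ᵇ≡false {m} {n} m≢n = ¬T⇒≡false (λ t → m≢n (≡ᵇ⇒≡ m n t))

boolToℕ : Bool → ℕ
boolToℕ true  = 1
boolToℕ false = 0

boolToℕ-∧-≤ : ∀ a b → boolToℕ (a ∧ b) ≤ boolToℕ b
boolToℕ-∧-≤ true  b = ≤-refl
boolToℕ-∧-≤ false b = z≤n

count : ℕ → List ℕ → ℕ
count k []      = 0
count k (x ∷ r) = boolToℕ (x ≡ᵇ k) + count k r

countMatched : ℕ → List ℕ → List ℕ → ℕ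
countMatched k []      _       = 0
countMatched k (_ ∷ _) []      = 0
countMatched k (y ∷ s) (x ∷ r) = boolToℕ ((y ≡ᵇ k) ∧ (x ≡ᵇ k)) + countMatched k s r

-- With s row i of α without its first entry and r row i + 1, count k r is C_{i+1,k}(α)
-- and countMatched k s r is E_{i,k}(α); rowWeight is the i-th row of factors of the weight.
rowWeight : List ℕ → List ℕ → List ℕ → ℕ
rowWeight K s r = product (map (λ k → count k r C countMatched k s r) K)

countMatched≤count : ∀ k s r → countMatched k s r ≤ count k r
countMatched≤count k []      r       = z≤n
countMatched≤count k (_ ∷ _) []      = z≤n
countMatched≤count k (y ∷ s) (x ∷ r) =
  +-mono-≤ (boolToℕ-∧-≤ (y ≡ᵇ k) (x ≡ᵇ k)) (countMatched≤count k s r)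

count-++ : ∀ k r₁ r₂ → count k (r₁ ++ r₂) ≡ count k r₁ + count k r₂
count-++ k []       r₂ = refl
count-++ k (x ∷ r₁) r₂ =
  trans (cong (boolToℕ (x ≡ᵇ k) +_) (count-++ k r₁ r₂)) (sym (+-assoc (boolToℕ (x ≡ᵇ k)) _ _))

countMatched-++ : ∀ k s₁ s₂ r₁ r₂ → length s₁ ≡ length r₁ →
  countMatched k (s₁ ++ s₂) (r₁ ++ r₂) ≡ countMatched k s₁ r₁ + countMatched k s₂ r₂
countMatched-++ k []       s₂ []       r₂ _   = refl
countMatched-++ k (y ∷ s₁) s₂ (x ∷ r₁) r₂ len =
  trans (cong (b +_) (countMatched-++ k s₁ s₂ r₁ r₂ (suc-injective len))) (sym (+-assoc b _ _))
  where
  b : ℕ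
  b = boolToℕ ((y ≡ᵇ k) ∧ (x ≡ᵇ k))

count-none : ∀ {k} r → All.All (_≢ k) r → count k r ≡ 0
count-none []      All.[]           = refl
count-none (x ∷ r) (x≢k All.∷ x∉r) = cong₂ _+_ (cong boolToℕ (≢⇒≡ᵇ≡false x≢k)) (count-none r x∉r)

count-unique : ∀ {k K} → k ∈ K → Unique K → count k K ≡ 1
count-unique {k} (here refl) (k∉K ∷ _) =
  cong₂ _+_ (cong boolToℕ (≡ᵇ-refl k)) (count-none _ (All.map (λ k≢x x≡k → k≢x (sym x≡k)) k∉K))
count-unique (there k∈K) (x∉K ∷ uK) =
  cong₂ _+_ (cong boolToℕ (≢⇒≡ᵇ≡false (All.lookup x∉K k∈K))) (count-unique k∈K uK)

count-replicate-≢ : ∀ {k v} M → v ≢ k → count k (replicate M v) ≡ 0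
count-replicate-≢ zero    v≢k = refl
count-replicate-≢ (suc M) v≢k = cong₂ _+_ (cong boolToℕ (≢⇒≡ᵇ≡false v≢k)) (count-replicate-≢ M v≢k)

count-replicate-≡ : ∀ M v → count v (replicate M v) ≡ M
count-replicate-≡ zero    v = refl
count-replicate-≡ (suc M) v = cong₂ _+_ (cong boolToℕ (≡ᵇ-refl v)) (count-replicate-≡ M v)

countMatched-replicate : ∀ M v → countMatched v (replicate M v) (replicate M v) ≡ M
countMatched-replicate zero    v = refl
countMatched-replicate (suc M) v =
  cong₂ _+_ (cong boolToℕ (cong₂ _∧_ (≡ᵇ-refl v) (≡ᵇ-refl v))) (countMatched-replicate M v)

countMatched-block : ∀ x l M → l ≤ M →
  countMatched (suc x) (replicate l x ++ replicate (M ∸ l) (suc x)) (replicate M (suc x)) ≡ M ∸ l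
countMatched-block x zero    M       _         = countMatched-replicate M (suc x)
countMatched-block x (suc l) (suc M) (s≤s l≤M) =
  cong₂ _+_ (cong (λ b → boolToℕ (b ∧ (x ≡ᵇ x))) (≢⇒≡ᵇ≡false (<⇒≢ (n<1+n x))))
            (countMatched-block x l M l≤M)

[m+n]C[j+k]≡mCj*nCk : ∀ {m n j k} → j ≤ m → k ≤ n → m ≡ 0 ⊎ n ≡ 0 →
  (m + n) C (j + k) ≡ (m C j) * (n C k)
[m+n]C[j+k]≡mCj*nCk {n = n} {k = k} j≤0 _ (inj₁ refl)
  rewrite n≤0⇒n≡0 j≤0 = sym (+-identityʳ (n C k))
[m+n]C[j+k]≡mCj*nCk {m = m} {j = j} _ k≤0 (inj₂ refl)
  rewrite n≤0⇒n≡0 k≤0 | +-identityʳ m | +-identityʳ j = sym (*-identityʳ (m C j))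

rowWeight-++ : ∀ K s₁ s₂ r₁ r₂ → length s₁ ≡ length r₁ →
  (∀ k → count k r₁ ≡ 0 ⊎ count k r₂ ≡ 0) →
  rowWeight K (s₁ ++ s₂) (r₁ ++ r₂) ≡ rowWeight K s₁ r₁ * rowWeight K s₂ r₂
rowWeight-++ K s₁ s₂ r₁ r₂ len disjoint =
  trans (cong product (map-cong factor K))
        (product-map-* (λ k → count k r₁ C countMatched k s₁ r₁)
                       (λ k → count k r₂ C countMatched k s₂ r₂) K)
  where
  factor : ∀ k → count k (r₁ ++ r₂) C countMatched k (s₁ ++ s₂) (r₁ ++ r₂)
               ≡ (count k r₁ C countMatched k s₁ r₁) * (count k r₂ C countMatched k s₂ r₂)
  factor k = trans (cong₂ _C_ (count-++ k r₁ r₂) (countMatched-++ k s₁ s₂ r₁ r₂ len))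
    ([m+n]C[j+k]≡mCj*nCk (countMatched≤count k s₁ r₁) (countMatched≤count k s₂ r₂) (disjoint k))

product-pow-count : ∀ B v K → product (map (λ k → B ^ boolToℕ (k ≡ᵇ v)) K) ≡ B ^ count v K
product-pow-count B v []      = refl
product-pow-count B v (k ∷ K) =
  trans (cong (B ^ boolToℕ (k ≡ᵇ v) *_) (product-pow-count B v K))
        (sym (^-distribˡ-+-* B (boolToℕ (k ≡ᵇ v)) (count v K)))

blockWeight : ∀ K x l M → l ≤ M →
  rowWeight K (replicate l x ++ replicate (M ∸ l) (suc x)) (replicate M (suc x))
    ≡ (M C (M ∸ l)) ^ count (suc x) K
blockWeight K x l M l≤M = trans (cong product (map-cong factor K)) (product-pow-count B (suc x) K)
  where
  B : ℕ
  B = M C (M ∸ l)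
  s r : List ℕ
  s = replicate l x ++ replicate (M ∸ l) (suc x)
  r = replicate M (suc x)
  factor : ∀ k → count k r C countMatched k s r ≡ B ^ boolToℕ (k ≡ᵇ suc x)
  factor k with k ≟ suc x
  ... | yes refl = begin
    count (suc x) r C countMatched (suc x) s r
      ≡⟨ cong₂ _C_ (count-replicate-≡ M (suc x)) (countMatched-block x l M l≤M) ⟩
    B      ≡⟨ *-identityʳ B ⟨
    B ^ 1  ≡⟨ cong (λ b → B ^ boolToℕ b) (≡ᵇ-refl x) ⟨
    B ^ boolToℕ (suc x ≡ᵇ suc x) ∎
    where open ≡-Reasoning
  ... | no k≢v = trans (cong₂ _C_ none (n≤0⇒n≡0 (≤-trans (countMatched≤count k s r) (≤-reflexive none))))
                       (cong (λ b → B ^ boolToℕ b) (sym (≢⇒≡ᵇ≡false k≢v)))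
    where
    none : count k r ≡ 0
    none = count-replicate-≢ M (λ v≡k → k≢v (sym v≡k))

-- Raising a row by zero or one, entrywise

when : {A : Set} → Bool → List A → List A
when b xs = if b then xs else []

∈-when : ∀ {A : Set} b {xs : List A} {a} → a ∈ when b xs → T b × a ∈ xs
∈-when true a∈xs = _ , a∈xs

Unique-when : ∀ {A : Set} b {xs : List A} → Unique xs → Unique (when b xs)
Unique-when true  u = u
Unique-when false u = []

data Raise : ℕ → List ℕ → List ℕ → Set where
  []   : ∀ {lo} → Raise lo [] []
  keep : ∀ {lo x c s} → lo ≤ x     → Raise x c s       → Raise lo (x ∷ c) (x ∷ s)
  bump : ∀ {lo x c s} → lo ≤ suc x → Raise (suc x) c s → Raise lo (x ∷ c) (suc x ∷ s)

raises : ℕ → List ℕ → List (List ℕ)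
raises lo []      = [] ∷ []
raises lo (x ∷ c) = when (lo ≤ᵇ x)     (map (x ∷_)     (raises x c))
                 ++ when (lo ≤ᵇ suc x) (map (suc x ∷_) (raises (suc x) c))

raises-sound : ∀ {lo} c {s} → s ∈ raises lo c → Raise lo c s
raises-sound []          (here refl) = []
raises-sound {lo} (x ∷ c) s∈ with ∈-++⁻ (when (lo ≤ᵇ x) (map (x ∷_) (raises x c))) s∈
... | inj₁ s∈keep with ∈-when (lo ≤ᵇ x) s∈keep
...   | t , s∈map with ∈-map⁻ (x ∷_) s∈map
...     | s′ , s′∈ , refl = keep (≤ᵇ⇒≤ lo x t) (raises-sound c s′∈)
raises-sound {lo} (x ∷ c) s∈ | inj₂ s∈bump with ∈-when (lo ≤ᵇ suc x) s∈bump
...   | t , s∈map with ∈-map⁻ (suc x ∷_) s∈map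
...     | s′ , s′∈ , refl = bump (≤ᵇ⇒≤ lo (suc x) t) (raises-sound c s′∈)

raises-complete : ∀ {lo c s} → Raise lo c s → s ∈ raises lo c
raises-complete []                 = here refl
raises-complete (keep lo≤x r)      rewrite T⇒≡true (≤⇒≤ᵇ lo≤x) =
  ∈-++⁺ˡ (∈-map⁺ _ (raises-complete r))
raises-complete {lo} {x ∷ c} (bump lo≤1+x r) rewrite T⇒≡true (≤⇒≤ᵇ lo≤1+x) =
  ∈-++⁺ʳ (when (lo ≤ᵇ x) (map (x ∷_) (raises x c))) (∈-map⁺ _ (raises-complete r))

raises-unique : ∀ lo c → Unique (raises lo c)
raises-unique lo []      = All.[] ∷ []
raises-unique lo (x ∷ c) = Unique.++⁺
  (Unique-when (lo ≤ᵇ x)     (Unique.map⁺ (λ e → proj₂ (∷-injective e)) (raises-unique x c)))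
  (Unique-when (lo ≤ᵇ suc x) (Unique.map⁺ (λ e → proj₂ (∷-injective e)) (raises-unique (suc x) c)))
  disjoint
  where
  disjoint : ∀ {s} → s ∈ when (lo ≤ᵇ x) (map (x ∷_) (raises x c))
                   × s ∈ when (lo ≤ᵇ suc x) (map (suc x ∷_) (raises (suc x) c)) → ⊥
  disjoint (s∈keep , s∈bump) with ∈-map⁻ _ (proj₂ (∈-when (lo ≤ᵇ x) s∈keep))
                                | ∈-map⁻ _ (proj₂ (∈-when (lo ≤ᵇ suc x) s∈bump))
  ... | _ , _ , refl | _ , _ , e = <⇒≢ (n<1+n x) (proj₁ (∷-injective e))

raises-≤ : ∀ {lo x} c → lo ≤ x →
  raises lo (x ∷ c) ≡ map (x ∷_) (raises x c) ++ map (suc x ∷_) (raises (suc x) c)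
raises-≤ c lo≤x rewrite T⇒≡true (≤⇒≤ᵇ lo≤x) | T⇒≡true (≤⇒≤ᵇ (m≤n⇒m≤1+n lo≤x)) = refl

raises-suc : ∀ x c → raises (suc x) (x ∷ c) ≡ map (suc x ∷_) (raises (suc x) c)
raises-suc x c
  rewrite ¬T⇒≡false (λ t → n≮n x (≤ᵇ⇒≤ (suc x) x t)) | T⇒≡true (≤⇒≤ᵇ (≤-refl {suc x})) = refl

raises-irrelevant : ∀ {lo lo′ y} c → lo ≤ y → lo′ ≤ y → raises lo (y ∷ c) ≡ raises lo′ (y ∷ c)
raises-irrelevant c lo≤y lo′≤y = trans (raises-≤ c lo≤y) (sym (raises-≤ c lo′≤y))

Raise-length : ∀ {lo c s} → Raise lo c s → length s ≡ length c
Raise-length []         = refl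
Raise-length (keep _ r) = cong suc (Raise-length r)
Raise-length (bump _ r) = cong suc (Raise-length r)

Raise-≥ : ∀ {lo c s} → Raise lo c s → ∀ j {v} → nth s j ≡ just v → lo ≤ v
Raise-≥ (keep lo≤x _) zero    refl = lo≤x
Raise-≥ (keep lo≤x r) (suc j) s≡v  = ≤-trans lo≤x (Raise-≥ r j s≡v)
Raise-≥ (bump lo≤x _) zero    refl = lo≤x
Raise-≥ (bump lo≤x r) (suc j) s≡v  = ≤-trans lo≤x (Raise-≥ r j s≡v)

Raise-between : ∀ {lo c s} → Raise lo c s → ∀ j {v} → nth s j ≡ just v →
  ∃ λ u → nth c j ≡ just u × u ≤ v × v ≤ suc u
Raise-between (keep {x = x} _ _) zero    refl = x , refl , ≤-refl , n≤1+n x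
Raise-between (keep _ r)         (suc j) s≡v  = Raise-between r j s≡v
Raise-between (bump {x = x} _ _) zero    refl = x , refl , n≤1+n x , ≤-refl
Raise-between (bump _ r)         (suc j) s≡v  = Raise-between r j s≡v

Raise-sorted : ∀ {lo c s} → Raise lo c s → ∀ j {v w} → nth s j ≡ just v → nth s (suc j) ≡ just w → v ≤ w
Raise-sorted (keep _ r) zero    refl s≡w = Raise-≥ r 0 s≡w
Raise-sorted (keep _ r) (suc j) s≡v  s≡w = Raise-sorted r j s≡v s≡w
Raise-sorted (bump _ r) zero    refl s≡w = Raise-≥ r 0 s≡w
Raise-sorted (bump _ r) (suc j) s≡v  s≡w = Raise-sorted r j s≡v s≡w

Raise-from-nth : ∀ lo c s → length s ≡ length c →
  (∀ {v} → nth s 0 ≡ just v → lo ≤ v) →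
  (∀ j {u v} → nth c j ≡ just u → nth s j ≡ just v → u ≤ v × v ≤ suc u) →
  (∀ j {v w} → nth s j ≡ just v → nth s (suc j) ≡ just w → v ≤ w) →
  Raise lo c s
Raise-from-nth lo []      []      _   _     _       _      = []
Raise-from-nth lo (x ∷ c) (y ∷ s) len first between sorted with between 0 refl refl
... | x≤y , y≤1+x with m≤n⇒m<n∨m≡n x≤y
...   | inj₂ refl = keep (first refl)
        (Raise-from-nth x c s (suc-injective len) (sorted 0 refl)
                        (λ j → between (suc j)) (λ j → sorted (suc j)))
...   | inj₁ x<y with ≤-antisym y≤1+x x<y
...     | refl = bump (first refl)
        (Raise-from-nth (suc x) c s (suc-injective len) (sorted 0 refl)
                        (λ j → between (suc j)) (λ j → sorted (suc j)))

sum-raises-above : ∀ x c m (F : List ℕ → ℕ) →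
  sum (map F (raises (suc x) (replicate m x ++ c)))
    ≡ sum (map (λ s → F (replicate m (suc x) ++ s)) (raises (suc x) c))
sum-raises-above x c zero    F = refl
sum-raises-above x c (suc m) F = begin
  sum (map F (raises (suc x) (x ∷ replicate m x ++ c)))
    ≡⟨ cong (λ ss → sum (map F ss)) (raises-suc x (replicate m x ++ c)) ⟩
  sum (map F (map (suc x ∷_) (raises (suc x) (replicate m x ++ c))))
    ≡⟨ sum-map-map F (suc x ∷_) (raises (suc x) (replicate m x ++ c)) ⟩
  sum (map (λ s → F (suc x ∷ s)) (raises (suc x) (replicate m x ++ c)))
    ≡⟨ sum-raises-above x c m (λ s → F (suc x ∷ s)) ⟩
  sum (map (λ s → F (replicate (suc m) (suc x) ++ s)) (raises (suc x) c)) ∎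
  where open ≡-Reasoning

-- A weakly increasing raise of a constant block x … x is x … x (x+1) … (x+1); l counts the x's.
sum-raises-block : ∀ x c → All.All (x <_) c → ∀ m {lo} → lo ≤ x → (F : List ℕ → ℕ) →
  sum (map F (raises lo (replicate m x ++ c)))
    ≡ ∑[ l < suc m ] sum (map (λ s → F (replicate l x ++ replicate (m ∸ l) (suc x) ++ s)) (raises (suc x) c))
sum-raises-block x c x<c zero lo≤x F =
  trans (cong (λ ss → sum (map F ss)) (lower-bound-irrelevant c x<c)) (sym (+-identityʳ _))
  where
  lower-bound-irrelevant : ∀ c → All.All (x <_) c → raises _ c ≡ raises (suc x) c
  lower-bound-irrelevant []      _             = refl
  lower-bound-irrelevant (y ∷ c) (x<y All.∷ _) = raises-irrelevant c (≤-trans lo≤x (<⇒≤ x<y)) x<y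
sum-raises-block x c x<c (suc m) {lo} lo≤x F = begin
  sum (map F (raises lo (x ∷ rest)))
    ≡⟨ cong (λ ss → sum (map F ss)) (raises-≤ rest lo≤x) ⟩
  sum (map F (map (x ∷_) (raises x rest) ++ map (suc x ∷_) (raises (suc x) rest)))
    ≡⟨ sum-map-++ F (map (x ∷_) (raises x rest)) _ ⟩
  sum (map F (map (x ∷_) (raises x rest))) + sum (map F (map (suc x ∷_) (raises (suc x) rest)))
    ≡⟨ cong₂ _+_ (sum-map-map F (x ∷_) (raises x rest)) (sum-map-map F (suc x ∷_) (raises (suc x) rest)) ⟩
  sum (map (λ s → F (x ∷ s)) (raises x rest)) + sum (map (λ s → F (suc x ∷ s)) (raises (suc x) rest))
    ≡⟨ cong₂ _+_ (sum-raises-block x c x<c m ≤-refl (λ s → F (x ∷ s)))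
                 (sum-raises-above x c m (λ s → F (suc x ∷ s))) ⟩
  withX + allHigh
    ≡⟨ +-comm withX allHigh ⟩
  allHigh + withX ∎
  where
  open ≡-Reasoning
  rest : List ℕ
  rest = replicate m x ++ c
  withX allHigh : ℕ
  withX = ∑[ l < suc m ] sum (map (λ s → F (x ∷ replicate l x ++ replicate (m ∸ l) (suc x) ++ s))
                                 (raises (suc x) c))
  allHigh = sum (map (λ s → F (suc x ∷ replicate m (suc x) ++ s)) (raises (suc x) c))

-- The sum of the row-1 factors

AllButLast : (ℕ → Set) → List ℕ → Set
AllButLast P = Linked (λ x _ → P x)

AllButLast-++⁻ : ∀ {P} xs {y ys} → AllButLast P (xs ++ y ∷ ys) → All.All P xs × AllButLast P (y ∷ ys)
AllButLast-++⁻ []            ok         = All.[] , ok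
AllButLast-++⁻ (x ∷ [])      (px ∷ ok) = px All.∷ All.[] , ok
AllButLast-++⁻ (x ∷ x′ ∷ xs) (px ∷ ok) =
  let pxs , ok′ = AllButLast-++⁻ (x′ ∷ xs) ok in px All.∷ pxs , ok′

AllButLast-replicate : ∀ {P x} m → AllButLast P (replicate (suc m) x ++ []) → P x ⊎ suc m ≡ 1
AllButLast-replicate zero    _         = inj₂ refl
AllButLast-replicate (suc m) (px ∷ _) = inj₁ px

replicate-++-∷ : ∀ m (x : ℕ) c → replicate m x ++ x ∷ c ≡ x ∷ replicate m x ++ c
replicate-++-∷ zero    x c = refl
replicate-++-∷ (suc m) x c = cong (x ∷_) (replicate-++-∷ m x c)

rowWeight-[] : ∀ K → rowWeight K [] [] ≡ 1
rowWeight-[] []      = refl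
rowWeight-[] (k ∷ K) = trans (+-identityʳ _) (rowWeight-[] K)

raiseTotal : ℕ → ℕ → List ℕ → ℕ
raiseTotal N lo c = sum (map (λ s → rowWeight (range 1 N) s (map suc c)) (raises lo c))

-- x + 1 lies in range 1 N when x < N; otherwise the block is a single entry and its factor is 1 anyway.
pow-count-range : ∀ N x M l → l ≤ M → x < N ⊎ M ≡ 1 →
  (M C (M ∸ l)) ^ count (suc x) (range 1 N) ≡ M C (M ∸ l)
pow-count-range N x M l _ (inj₁ x<N) =
  trans (cong ((M C (M ∸ l)) ^_)
    (count-unique (∈-map⁺ suc (∈-upTo⁺ x<N)) (Unique.map⁺ suc-injective (Unique.upTo⁺ N))))
        (*-identityʳ _)
pow-count-range N x .1 zero          _         (inj₂ refl) = ^-zeroˡ (count (suc x) (range 1 N))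
pow-count-range N x .1 (suc zero)    _         (inj₂ refl) = ^-zeroˡ (count (suc x) (range 1 N))
pow-count-range N x .1 (suc (suc l)) (s≤s ())  (inj₂ refl)

rowWeight-block : ∀ N M x c l s → l ≤ M → All.All (x <_) c → x < N ⊎ M ≡ 1 →
  rowWeight (range 1 N) (replicate l x ++ replicate (M ∸ l) (suc x) ++ s) (map suc (replicate M x ++ c))
    ≡ (M C (M ∸ l)) * rowWeight (range 1 N) s (map suc c)
rowWeight-block N M x c l s l≤M x<c fits = begin
  rowWeight K (replicate l x ++ replicate (M ∸ l) (suc x) ++ s) (map suc (replicate M x ++ c))
    ≡⟨ cong₂ (rowWeight K) (++-assoc (replicate l x) (replicate (M ∸ l) (suc x)) s) r≡ ⟨
  rowWeight K (prefix ++ s) (replicate M (suc x) ++ map suc c)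
    ≡⟨ rowWeight-++ K prefix s (replicate M (suc x)) (map suc c) length-prefix disjoint ⟩
  rowWeight K prefix (replicate M (suc x)) * rowWeight K s (map suc c)
    ≡⟨ cong (_* rowWeight K s (map suc c)) (trans (blockWeight K x l M l≤M) (pow-count-range N x M l l≤M fits)) ⟩
  (M C (M ∸ l)) * rowWeight K s (map suc c) ∎
  where
  open ≡-Reasoning
  K prefix : List ℕ
  K = range 1 N
  prefix = replicate l x ++ replicate (M ∸ l) (suc x)
  r≡ : replicate M (suc x) ++ map suc c ≡ map suc (replicate M x ++ c)
  r≡ = sym (trans (map-++ suc (replicate M x) c) (cong (_++ map suc c) (map-replicate suc M x)))
  disjoint : ∀ k → count k (replicate M (suc x)) ≡ 0 ⊎ count k (map suc c) ≡ 0
  disjoint k with k ≟ suc x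
  ... | yes refl =
    inj₂ (count-none (map suc c) (map⁺ (All.map (λ x<y 1+y≡1+x → <⇒≢ x<y (suc-injective (sym 1+y≡1+x))) x<c)))
  ... | no k≢1+x = inj₁ (count-replicate-≢ M (λ 1+x≡k → k≢1+x (sym 1+x≡k)))
  length-prefix : length prefix ≡ length (replicate M (suc x))
  length-prefix = begin
    length prefix                    ≡⟨ length-++ (replicate l x) ⟩
    length (replicate l x) + length (replicate (M ∸ l) (suc x))
      ≡⟨ cong₂ _+_ (length-replicate l) (length-replicate (M ∸ l)) ⟩
    l + (M ∸ l)                      ≡⟨ m+[n∸m]≡n l≤M ⟩
    M                                ≡⟨ length-replicate M ⟨
    length (replicate M (suc x))     ∎

raiseTotal-block : ∀ N M x c {lo} → lo ≤ x → All.All (x <_) c → x < N ⊎ M ≡ 1 →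
  raiseTotal N lo (replicate M x ++ c) ≡ 2 ^ M * raiseTotal N (suc x) c
raiseTotal-block N M x c {lo} lo≤x x<c fits = begin
  raiseTotal N lo (replicate M x ++ c)
    ≡⟨ sum-raises-block x c x<c M lo≤x (λ s → rowWeight K s (map suc (replicate M x ++ c))) ⟩
  ∑[ l < suc M ] sum (map (λ s → rowWeight K (replicate l x ++ replicate (M ∸ l) (suc x) ++ s)
                                            (map suc (replicate M x ++ c))) (raises (suc x) c))
    ≡⟨ ∑-cong (suc M) (λ l<1+M → factorBlock (≤-pred l<1+M)) ⟩
  ∑[ l < suc M ] ((M C (M ∸ l)) * raiseTotal N (suc x) c)
    ≡⟨ ∑-*ʳ (λ l → M C (M ∸ l)) _ (suc M) ⟩
  ∑[ l < suc M ] (M C (M ∸ l)) * raiseTotal N (suc x) c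
    ≡⟨ cong (_* raiseTotal N (suc x) c) (∑-binomial-reversed M) ⟩
  2 ^ M * raiseTotal N (suc x) c ∎
  where
  open ≡-Reasoning
  K : List ℕ
  K = range 1 N
  factorBlock : ∀ {l} → l ≤ M →
    sum (map (λ s → rowWeight K (replicate l x ++ replicate (M ∸ l) (suc x) ++ s) (map suc (replicate M x ++ c)))
             (raises (suc x) c))
      ≡ (M C (M ∸ l)) * raiseTotal N (suc x) c
  factorBlock {l} l≤M =
    trans (cong sum (map-cong (λ s → rowWeight-block N M x c l s l≤M x<c fits) (raises (suc x) c)))
          (sum-map-*ˡ (λ s → rowWeight K s (map suc c)) (M C (M ∸ l)) (raises (suc x) c))

raiseTotal-replicate : ∀ N m {lo x} c → lo ≤ x → Linked _≤_ (x ∷ c) →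
  AllButLast (_< N) (replicate (suc m) x ++ c) →
  raiseTotal N lo (replicate (suc m) x ++ c) ≡ 2 ^ (suc m + length c)
raiseTotal-replicate N m {lo} {x} [] lo≤x _ ok = begin
  raiseTotal N lo (replicate (suc m) x ++ [])
    ≡⟨ raiseTotal-block N (suc m) x [] lo≤x All.[] (AllButLast-replicate m ok) ⟩
  2 ^ suc m * (rowWeight (range 1 N) [] [] + 0)
    ≡⟨ cong (2 ^ suc m *_) (trans (+-identityʳ _) (rowWeight-[] (range 1 N))) ⟩
  2 ^ suc m * 1
    ≡⟨ *-identityʳ _ ⟩
  2 ^ suc m
    ≡⟨ cong (2 ^_) (+-identityʳ (suc m)) ⟨
  2 ^ (suc m + 0) ∎
  where open ≡-Reasoning
raiseTotal-replicate N m {lo} {x} (y ∷ c) lo≤x (x≤y ∷ y≤c) ok with m≤n⇒m<n∨m≡n x≤y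
... | inj₂ refl = begin
  raiseTotal N lo (replicate (suc m) x ++ x ∷ c)
    ≡⟨ cong (raiseTotal N lo) (replicate-++-∷ (suc m) x c) ⟩
  raiseTotal N lo (replicate (suc (suc m)) x ++ c)
    ≡⟨ raiseTotal-replicate N (suc m) c lo≤x y≤c (subst (AllButLast (_< N)) (replicate-++-∷ (suc m) x c) ok) ⟩
  2 ^ (suc (suc m) + length c)
    ≡⟨ cong (2 ^_) (+-suc (suc m) (length c)) ⟨
  2 ^ (suc m + suc (length c)) ∎
  where open ≡-Reasoning
... | inj₁ x<y = begin
  raiseTotal N lo (replicate (suc m) x ++ y ∷ c)
    ≡⟨ raiseTotal-block N (suc m) x (y ∷ c) lo≤x (Linked⇒All ≤-trans x<y y≤c) (inj₁ (All.head block<N)) ⟩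
  2 ^ suc m * raiseTotal N (suc x) (y ∷ c)
    ≡⟨ cong (2 ^ suc m *_) (raiseTotal-replicate N 0 c x<y y≤c rest<N) ⟩
  2 ^ suc m * 2 ^ suc (length c)
    ≡⟨ ^-distribˡ-+-* 2 (suc m) (suc (length c)) ⟨
  2 ^ (suc m + suc (length c)) ∎
  where
  open ≡-Reasoning
  block<N : All.All (_< N) (replicate (suc m) x)
  block<N = proj₁ (AllButLast-++⁻ (replicate (suc m) x) ok)
  rest<N : AllButLast (_< N) (y ∷ c)
  rest<N = proj₂ (AllButLast-++⁻ (replicate (suc m) x) ok)

raiseTotal-sorted : ∀ N {lo} c → Linked _≤_ (lo ∷ c) → AllButLast (_< N) c → raiseTotal N lo c ≡ 2 ^ length c
raiseTotal-sorted N []      _               _  = trans (+-identityʳ _) (rowWeight-[] (range 1 N))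
raiseTotal-sorted N (x ∷ c) (lo≤x ∷ x≤c) ok = raiseTotal-replicate N 0 c lo≤x x≤c ok

-- Deleting the first row of an array

shift : Array → Array
shift = map (map suc)

firstRow : Array → List ℕ
firstRow []      = []
firstRow (r ∷ _) = r

nth-map : ∀ {A B : Set} (f : A → B) xs j → nth (map f xs) j ≡ Maybe.map f (nth xs j)
nth-map f []       j       = refl
nth-map f (x ∷ xs) zero    = refl
nth-map f (x ∷ xs) (suc j) = nth-map f xs j

nth-just⇒< : ∀ {A : Set} (xs : List A) j {v} → nth xs j ≡ just v → j < length xs
nth-just⇒< (x ∷ xs) zero    _   = s≤s z≤n
nth-just⇒< (x ∷ xs) (suc j) x≡v = s≤s (nth-just⇒< xs j x≡v)

nth-beyond : ∀ {A : Set} (xs : List A) j → length xs ≤ j → nth xs j ≡ nothing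
nth-beyond []       j       _         = refl
nth-beyond (x ∷ xs) (suc j) (s≤s len) = nth-beyond xs j len

nth-Linked : ∀ {R : ℕ → ℕ → Set} d →
  (∀ j {v w} → nth d j ≡ just v → nth d (suc j) ≡ just w → R v w) → Linked R d
nth-Linked []          _ = []
nth-Linked (x ∷ [])    _ = [-]
nth-Linked (x ∷ y ∷ d) R-nth = R-nth 0 refl refl ∷ nth-Linked (y ∷ d) (λ j → R-nth (suc j))

Maybe-map-just : ∀ {A B : Set} {f : A → B} m {v} → Maybe.map f m ≡ just v → ∃ λ u → m ≡ just u × v ≡ f u
Maybe-map-just (just u) refl = u , refl , refl

at-suc : ∀ α p j → at α (suc p) j ≡ (nth α p >>= λ r → nth r j)
at-suc α p j with nth α p
... | nothing = refl
... | just r  = refl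

at-firstRow : ∀ β j → at β 1 j ≡ nth (firstRow β) j
at-firstRow []      j = refl
at-firstRow (r ∷ β) j = refl

at-shift : ∀ r β p j → at (r ∷ shift β) (suc (suc p)) j ≡ Maybe.map suc (at β (suc p) j)
at-shift r β p j
  rewrite at-suc (r ∷ shift β) (suc p) j | at-suc β p j | nth-map (map suc) β p with nth β p
... | nothing  = refl
... | just row = nth-map suc row j

at-shift⁺ : ∀ r β p j {u} → at β (suc p) j ≡ just u → at (r ∷ shift β) (suc (suc p)) j ≡ just (suc u)
at-shift⁺ r β p j β≡u = trans (at-shift r β p j) (cong (Maybe.map suc) β≡u)

at-shift⁻ : ∀ r β p j {v} → at (r ∷ shift β) (suc (suc p)) j ≡ just v →
  ∃ λ u → at β (suc p) j ≡ just u × v ≡ suc u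
at-shift⁻ r β p j α≡v = Maybe-map-just (at β (suc p) j) (trans (sym (at-shift r β p j)) α≡v)

RowLengths : ℕ → Array → Set
RowLengths n α = ∀ p {r} → nth α p ≡ just r → length r ≡ n ∸ p

nth-lookup : ∀ {A : Set} (xs : List A) (p : Fin (length xs)) → nth xs (toℕ p) ≡ just (lookup xs p)
nth-lookup (x ∷ xs) fzero    = refl
nth-lookup (x ∷ xs) (fsuc p) = nth-lookup xs p

nth-just⇒lookup : ∀ {A : Set} (xs : List A) p {v} → nth xs p ≡ just v →
  ∃ λ (q : Fin (length xs)) → toℕ q ≡ p × lookup xs q ≡ v
nth-just⇒lookup (x ∷ xs) zero    refl = fzero , refl , refl
nth-just⇒lookup (x ∷ xs) (suc p) x≡v  =
  let q , q≡p , xs≡v = nth-just⇒lookup xs p x≡v in fsuc q , cong suc q≡p , xs≡v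

Shape⇒RowLengths : ∀ {n} α → Shape n α → RowLengths n α
Shape⇒RowLengths α (_ , rows) p α≡r with nth-just⇒lookup α p α≡r
... | q , refl , refl = rows q

RowLengths⇒Shape : ∀ {n} α → length α ≡ n → RowLengths n α → Shape n α
RowLengths⇒Shape α len rows = len , λ p → rows (toℕ p) (nth-lookup α p)

length-firstRow : ∀ {n} β → length β ≡ n → RowLengths n β → length (firstRow β) ≡ n
length-firstRow []      len _    = len
length-firstRow (r ∷ β) _   rows = rows 0 refl

-- Prepending the row (1, s) to the shifted β: rows ≥ 2 inherit every condition from β,
-- and the conditions linking rows 1 and 2 are exactly Raise 1 (firstRow β) s.
module _ {n β s} (Yβ : InY n β) (raise : Raise 1 (firstRow β) s) where
  private
    module Y = InY Yβ
    α : Array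
    α = (1 ∷ s) ∷ shift β
    c : List ℕ
    c = firstRow β
    lenβ : length β ≡ n
    lenβ = proj₁ Y.shape
    rowsβ : RowLengths n β
    rowsβ = Shape⇒RowLengths β Y.shape

    row2 : ∀ j {v} → at α 2 j ≡ just v → ∃ λ u → nth c j ≡ just u × v ≡ suc u
    row2 j α≡v = let u , β≡u , v≡1+u = at-shift⁻ (1 ∷ s) β 0 j α≡v in
      u , trans (sym (at-firstRow β j)) β≡u , v≡1+u

    rows : RowLengths (suc n) α
    rows zero    refl = cong suc (trans (Raise-length raise) (length-firstRow β lenβ rowsβ))
    rows (suc p) α≡r with Maybe-map-just (nth β p) (trans (sym (nth-map (map suc) β p)) α≡r)
    ... | u , β≡u , refl = trans (length-map suc u) (rowsβ p β≡u)

    col0 : ∀ i {v} → at α i 0 ≡ just v → v ≡ i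
    col0 1             refl = refl
    col0 (suc (suc p)) α≡v with at-shift⁻ (1 ∷ s) β p 0 α≡v
    ... | u , β≡u , refl = cong suc (Y.col0 (suc p) u β≡u)

    lower : ∀ i j {v} → at α i j ≡ just v → i ≤ v
    lower 1             zero    refl = ≤-refl
    lower 1             (suc j) α≡v  = Raise-≥ raise j α≡v
    lower (suc (suc p)) j       α≡v  with at-shift⁻ (1 ∷ s) β p j α≡v
    ... | u , β≡u , refl = s≤s (Y.lower (suc p) j u β≡u)

    upper : ∀ i j {v} → at α i j ≡ just v → v ≤ i + j
    upper 1             zero    refl = ≤-refl
    upper 1             (suc j) α≡v  with Raise-between raise j α≡v
    ... | u , c≡u , _ , v≤1+u = ≤-trans v≤1+u (s≤s (Y.upper 1 j u (trans (at-firstRow β j) c≡u)))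
    upper (suc (suc p)) j       α≡v  with at-shift⁻ (1 ∷ s) β p j α≡v
    ... | u , β≡u , refl = s≤s (Y.upper (suc p) j u β≡u)

    condNE : ∀ i j {v w} → at α (suc i) j ≡ just v → at α i (suc j) ≡ just w → v ≤ suc w
    condNE 1             j α≡v α≡w with row2 j α≡v | Raise-between raise j α≡w
    ... | u , c≡u , refl | u′ , c≡u′ , u′≤w , _ with just-injective (trans (sym c≡u) c≡u′)
    ...   | refl = s≤s u′≤w
    condNE (suc (suc p)) j α≡v α≡w
      with at-shift⁻ (1 ∷ s) β (suc p) j α≡v | at-shift⁻ (1 ∷ s) β p (suc j) α≡w
    ... | u , β≡u , refl | u′ , β≡u′ , refl = s≤s (Y.condNE (suc p) j u u′ β≡u β≡u′)

    condSW : ∀ i j {v w} → at α i (suc j) ≡ just v → at α (suc i) j ≡ just w → v ≤ w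
    condSW 1             j α≡v α≡w with row2 j α≡w | Raise-between raise j α≡v
    ... | u , c≡u , refl | u′ , c≡u′ , _ , v≤1+u′ with just-injective (trans (sym c≡u) c≡u′)
    ...   | refl = v≤1+u′
    condSW (suc (suc p)) j α≡v α≡w
      with at-shift⁻ (1 ∷ s) β p (suc j) α≡v | at-shift⁻ (1 ∷ s) β (suc p) j α≡w
    ... | u , β≡u , refl | u′ , β≡u′ , refl = s≤s (Y.condSW (suc p) j u u′ β≡u β≡u′)

    condE : ∀ i j {v w} → at α i j ≡ just v → at α i (suc j) ≡ just w → v ≤ w
    condE 1             zero    refl α≡w = Raise-≥ raise 0 α≡w
    condE 1             (suc j) α≡v  α≡w = Raise-sorted raise j α≡v α≡w
    condE (suc (suc p)) j       α≡v  α≡w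
      with at-shift⁻ (1 ∷ s) β p j α≡v | at-shift⁻ (1 ∷ s) β p (suc j) α≡w
    ... | u , β≡u , refl | u′ , β≡u′ , refl = s≤s (Y.condE (suc p) j u u′ β≡u β≡u′)

  InY-cons⁺ : InY (suc n) ((1 ∷ s) ∷ shift β)
  InY-cons⁺ = record
    { shape  = RowLengths⇒Shape α (cong suc (trans (length-map (map suc) β) lenβ)) rows
    ; col0   = λ i v → col0 i
    ; lower  = λ i j v → lower i j
    ; upper  = λ i j v → upper i j
    ; condNE = λ i j v w → condNE i j
    ; condSW = λ i j v w → condSW i j
    ; condE  = λ i j v w → condE i j
    }

module _ {n β s} (Yα : InY (suc n) ((1 ∷ s) ∷ shift β)) where
  private
    module Y = InY Yα
    α : Array
    α = (1 ∷ s) ∷ shift β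
    rowsα : RowLengths (suc n) α
    rowsα = Shape⇒RowLengths α Y.shape

    rows : RowLengths n β
    rows p {r} β≡r = trans (sym (length-map suc r))
      (rowsα (suc p) (trans (nth-map (map suc) β p) (cong (Maybe.map (map suc)) β≡r)))

    lenβ : length β ≡ n
    lenβ = trans (sym (length-map (map suc) β)) (suc-injective (proj₁ Y.shape))

    below : ∀ p j {u} → at β (suc p) j ≡ just u → at α (suc (suc p)) j ≡ just (suc u)
    below = at-shift⁺ (1 ∷ s) β

    col0 : ∀ i {v} → at β i 0 ≡ just v → v ≡ i
    col0 (suc p) β≡v = suc-injective (Y.col0 (suc (suc p)) _ (below p 0 β≡v))

    lower : ∀ i j {v} → at β i j ≡ just v → i ≤ v
    lower (suc p) j β≡v = ≤-pred (Y.lower (suc (suc p)) j _ (below p j β≡v))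

    upper : ∀ i j {v} → at β i j ≡ just v → v ≤ i + j
    upper (suc p) j β≡v = ≤-pred (Y.upper (suc (suc p)) j _ (below p j β≡v))

    condNE : ∀ i j {v w} → at β (suc i) j ≡ just v → at β i (suc j) ≡ just w → v ≤ suc w
    condNE (suc p) j β≡v β≡w =
      ≤-pred (Y.condNE (suc (suc p)) j _ _ (below (suc p) j β≡v) (below p (suc j) β≡w))

    condSW : ∀ i j {v w} → at β i (suc j) ≡ just v → at β (suc i) j ≡ just w → v ≤ w
    condSW (suc p) j β≡v β≡w =
      ≤-pred (Y.condSW (suc (suc p)) j _ _ (below p (suc j) β≡v) (below (suc p) j β≡w))

    condE : ∀ i j {v w} → at β i j ≡ just v → at β i (suc j) ≡ just w → v ≤ w
    condE (suc p) j β≡v β≡w = ≤-pred (Y.condE (suc (suc p)) j _ _ (below p j β≡v) (below p (suc j) β≡w))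

    row2 : ∀ j {u} → nth (firstRow β) j ≡ just u → at α 2 j ≡ just (suc u)
    row2 j c≡u = below 0 j (trans (at-firstRow β j) c≡u)

    raise : Raise 1 (firstRow β) s
    raise = Raise-from-nth 1 (firstRow β) s
      (trans (suc-injective (rowsα 0 refl)) (sym (length-firstRow β lenβ rows)))
      (Y.condE 1 0 1 _ refl)
      (λ j c≡u s≡v → ≤-pred (Y.condNE 1 j _ _ (row2 j c≡u) s≡v) , Y.condSW 1 j _ _ s≡v (row2 j c≡u))
      (λ j → Y.condE 1 (suc j) _ _)

  InY-cons⁻ : InY n β × Raise 1 (firstRow β) s
  InY-cons⁻ = record
    { shape  = RowLengths⇒Shape β lenβ rows
    ; col0   = λ i v → col0 i
    ; lower  = λ i j v → lower i j
    ; upper  = λ i j v → upper i j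
    ; condNE = λ i j v w → condNE i j
    ; condSW = λ i j v w → condSW i j
    ; condE  = λ i j v w → condE i j
    } , raise

unshift : Array → Array
unshift = map (map pred)

shift-unshift : ∀ α → (∀ p j {v} → (nth α p >>= λ r → nth r j) ≡ just v → 1 ≤ v) →
  shift (unshift α) ≡ α
shift-unshift []      _        = refl
shift-unshift (r ∷ α) positive = cong₂ _∷_ (row r (positive 0)) (shift-unshift α (λ p → positive (suc p)))
  where
  row : ∀ r → (∀ j {v} → nth r j ≡ just v → 1 ≤ v) → map suc (map pred r) ≡ r
  row []          _        = refl
  row (zero ∷ r)  positive with () ← positive 0 refl
  row (suc v ∷ r) positive = cong (suc v ∷_) (row r (λ j → positive (suc j)))

InY-suc⁻ : ∀ {n} α → InY (suc n) α → ∃₂ λ β s → α ≡ (1 ∷ s) ∷ shift β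
InY-suc⁻ []               Y with () ← proj₁ (InY.shape Y)
InY-suc⁻ ([] ∷ α)         Y with () ← Shape⇒RowLengths ([] ∷ α) (InY.shape Y) 0 refl
InY-suc⁻ ((x ∷ s) ∷ α)    Y with InY.col0 Y 1 x refl
... | refl = unshift α , s , cong ((1 ∷ s) ∷_) (sym (shift-unshift α positive))
  where
  positive : ∀ p j {v} → (nth α p >>= λ r → nth r j) ≡ just v → 1 ≤ v
  positive p j α≡v =
    ≤-trans (s≤s z≤n) (InY.lower Y (suc (suc p)) j _ (trans (at-suc ((1 ∷ s) ∷ α) (suc p) j) α≡v))

-- Decomposition of the weight

length-filterᵇ-applyUpTo : ∀ (p : ℕ → Bool) f N →
  length (filterᵇ p (applyUpTo f N)) ≡ ∑[ j < N ] boolToℕ (p (f j))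
length-filterᵇ-applyUpTo p f zero    = refl
length-filterᵇ-applyUpTo p f (suc N) with p (f 0)
... | true  = cong suc (length-filterᵇ-applyUpTo p (λ j → f (suc j)) N)
... | false = length-filterᵇ-applyUpTo p (λ j → f (suc j)) N

Cnt≡∑ : ∀ n α i k → Cnt n α i k ≡ ∑[ j < suc n ] boolToℕ (is (at α i j) k)
Cnt≡∑ n α i k = length-filterᵇ-applyUpTo (λ j → is (at α i j) k) (λ j → j) (suc n)

Ecnt≡∑ : ∀ n α i k →
  Ecnt n α i k ≡ ∑[ j < suc n ] boolToℕ (is (at α i (suc j)) k ∧ is (at α (suc i) j) k)
Ecnt≡∑ n α i k =
  length-filterᵇ-applyUpTo (λ j → is (at α i (suc j)) k ∧ is (at α (suc i) j) k) (λ j → j) (suc n)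

∑-0 : ∀ t → ∑[ j < t ] 0 ≡ 0
∑-0 zero    = refl
∑-0 (suc t) = ∑-0 t

∑-last-0 : ∀ f t → f t ≡ 0 → ∑< (suc t) f ≡ ∑< t f
∑-last-0 f t ft≡0 = trans (∑-last f t) (trans (cong (∑< t f +_) ft≡0) (+-identityʳ _))

∑-count : ∀ k r N → length r ≤ N → ∑[ j < N ] boolToℕ (is (nth r j) k) ≡ count k r
∑-count k []      N       _         = ∑-0 N
∑-count k (x ∷ r) (suc N) (s≤s len) = cong (boolToℕ (x ≡ᵇ k) +_) (∑-count k r N len)

∑-countMatched : ∀ k s r N → length s ≡ length r → length r ≤ N →
  ∑[ j < N ] boolToℕ (is (nth s j) k ∧ is (nth r j) k) ≡ countMatched k s r
∑-countMatched k []      []      N       _   _         = ∑-0 N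
∑-countMatched k (y ∷ s) (x ∷ r) (suc N) len (s≤s len≤) =
  cong (boolToℕ ((y ≡ᵇ k) ∧ (x ≡ᵇ k)) +_) (∑-countMatched k s r N (suc-injective len) len≤)

is-map-suc : ∀ m k → is (Maybe.map suc m) (suc k) ≡ is m k
is-map-suc nothing  k = refl
is-map-suc (just v) k = refl

at-beyond : ∀ {N} β → RowLengths N β → ∀ i j → N ≤ j → at β i j ≡ nothing
at-beyond β rows zero    j N≤j = refl
at-beyond β rows (suc p) j N≤j = trans (at-suc β p j) (row (nth β p) refl)
  where
  row : ∀ m → nth β p ≡ m → (m >>= λ r → nth r j) ≡ nothing
  row nothing  _    = refl
  row (just r) β≡r = nth-beyond r j (≤-trans (≤-reflexive (rows p β≡r)) (≤-trans (m∸n≤m _ p) N≤j))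

is-shift : ∀ r β p j k → is (at (r ∷ shift β) (suc (suc p)) j) (suc k) ≡ is (at β (suc p) j) k
is-shift r β p j k = trans (cong (λ m → is m (suc k)) (at-shift r β p j)) (is-map-suc (at β (suc p) j) k)

Cnt-shift : ∀ N β r → RowLengths N β → ∀ i k →
  Cnt (suc N) (r ∷ shift β) (suc (suc i)) (suc k) ≡ Cnt N β (suc i) k
Cnt-shift N β r rows i k = begin
  Cnt (suc N) (r ∷ shift β) (suc (suc i)) (suc k)
    ≡⟨ Cnt≡∑ (suc N) (r ∷ shift β) (suc (suc i)) (suc k) ⟩
  ∑[ j < suc (suc N) ] boolToℕ (is (at (r ∷ shift β) (suc (suc i)) j) (suc k))
    ≡⟨ ∑-cong (suc (suc N)) (λ {j} _ → cong boolToℕ (is-shift r β i j k)) ⟩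
  ∑[ j < suc (suc N) ] boolToℕ (is (at β (suc i) j) k)
    ≡⟨ ∑-last-0 (λ j → boolToℕ (is (at β (suc i) j) k)) (suc N)
         (cong (λ m → boolToℕ (is m k)) (at-beyond β rows (suc i) (suc N) (n≤1+n N))) ⟩
  ∑[ j < suc N ] boolToℕ (is (at β (suc i) j) k)
    ≡⟨ Cnt≡∑ N β (suc i) k ⟨
  Cnt N β (suc i) k ∎
  where open ≡-Reasoning

Ecnt-shift : ∀ N β r → RowLengths N β → ∀ i k →
  Ecnt (suc N) (r ∷ shift β) (suc (suc i)) (suc k) ≡ Ecnt N β (suc i) k
Ecnt-shift N β r rows i k = begin
  Ecnt (suc N) (r ∷ shift β) (suc (suc i)) (suc k)
    ≡⟨ Ecnt≡∑ (suc N) (r ∷ shift β) (suc (suc i)) (suc k) ⟩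
  ∑[ j < suc (suc N) ] boolToℕ (is (at α (suc (suc i)) (suc j)) (suc k) ∧ is (at α (suc (suc (suc i))) j) (suc k))
    ≡⟨ ∑-cong (suc (suc N))
         (λ {j} _ → cong boolToℕ (cong₂ _∧_ (is-shift r β i (suc j) k) (is-shift r β (suc i) j k))) ⟩
  ∑[ j < suc (suc N) ] boolToℕ (is (at β (suc i) (suc j)) k ∧ is (at β (suc (suc i)) j) k)
    ≡⟨ ∑-last-0 (λ j → boolToℕ (is (at β (suc i) (suc j)) k ∧ is (at β (suc (suc i)) j) k)) (suc N)
         (cong (λ m → boolToℕ (is m k ∧ is (at β (suc (suc i)) (suc N)) k))
         (at-beyond β rows (suc i) (suc (suc N)) (≤-trans (n≤1+n N) (n≤1+n (suc N))))) ⟩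
  ∑[ j < suc N ] boolToℕ (is (at β (suc i) (suc j)) k ∧ is (at β (suc (suc i)) j) k)
    ≡⟨ Ecnt≡∑ N β (suc i) k ⟨
  Ecnt N β (suc i) k ∎
  where
  open ≡-Reasoning
  α : Array
  α = r ∷ shift β

nth-row2 : ∀ s β j → at ((1 ∷ s) ∷ shift β) 2 j ≡ nth (map suc (firstRow β)) j
nth-row2 s β j = trans (at-shift (1 ∷ s) β 0 j)
  (trans (cong (Maybe.map suc) (at-firstRow β j)) (sym (nth-map suc (firstRow β) j)))

Cnt-row2 : ∀ N β s → length (firstRow β) ≤ suc N → ∀ k →
  Cnt N ((1 ∷ s) ∷ shift β) 2 k ≡ count k (map suc (firstRow β))
Cnt-row2 N β s len k =
  trans (Cnt≡∑ N ((1 ∷ s) ∷ shift β) 2 k)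
  (trans (∑-cong (suc N) (λ {j} _ → cong (λ m → boolToℕ (is m k)) (nth-row2 s β j)))
         (∑-count k (map suc (firstRow β)) (suc N) (≤-trans (≤-reflexive (length-map suc (firstRow β))) len)))

Ecnt-row1 : ∀ N β s → length s ≡ length (firstRow β) → length (firstRow β) ≤ suc N → ∀ k →
  Ecnt N ((1 ∷ s) ∷ shift β) 1 k ≡ countMatched k s (map suc (firstRow β))
Ecnt-row1 N β s lens len k =
  trans (Ecnt≡∑ N ((1 ∷ s) ∷ shift β) 1 k)
  (trans (∑-cong (suc N) (λ {j} _ → cong (λ m → boolToℕ (is (nth s j) k ∧ is m k)) (nth-row2 s β j)))
         (∑-countMatched k s (map suc (firstRow β)) (suc N) (trans lens (sym (length-map suc (firstRow β))))
                         (≤-trans (≤-reflexive (length-map suc (firstRow β))) len)))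

factors : ℕ → Array → ℕ → List ℕ
factors n α i = map (λ k → Cnt n α (suc i) k C Ecnt n α i k) (range i (n ∸ 1))

factors-shift : ∀ m β r → RowLengths (suc m) β → ∀ t →
  factors (suc (suc m)) (r ∷ shift β) (suc (suc t)) ≡ factors (suc m) β (suc t)
factors-shift m β r rows t = begin
  map (λ k → Cnt (suc (suc m)) α (suc (suc (suc t))) k C Ecnt (suc (suc m)) α (suc (suc t)) k)
      (map (suc (suc t) +_) (upTo (m ∸ t)))
    ≡⟨ map-∘ (upTo (m ∸ t)) ⟨
  map (λ u → Cnt (suc (suc m)) α (suc (suc (suc t))) (suc (suc t) + u)
           C Ecnt (suc (suc m)) α (suc (suc t)) (suc (suc t) + u))
      (upTo (m ∸ t))
    ≡⟨ map-cong (λ u → cong₂ _C_ (Cnt-shift (suc m) β r rows (suc t) (suc t + u))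
                                 (Ecnt-shift (suc m) β r rows t (suc t + u)))
                (upTo (m ∸ t)) ⟩
  map (λ u → Cnt (suc m) β (suc (suc t)) (suc t + u) C Ecnt (suc m) β (suc t) (suc t + u)) (upTo (m ∸ t))
    ≡⟨ map-∘ (upTo (m ∸ t)) ⟩
  factors (suc m) β (suc t) ∎
  where
  open ≡-Reasoning
  α : Array
  α = r ∷ shift β

weight-cons : ∀ n β s → RowLengths n β → length (firstRow β) ≡ n → length s ≡ length (firstRow β) →
  weight (suc n) ((1 ∷ s) ∷ shift β) ≡ rowWeight (range 1 n) s (map suc (firstRow β)) * weight n β
weight-cons zero    β s _    _    _    = refl
weight-cons (suc m) β s rows lenc lens = begin
  weight (suc (suc m)) α
    ≡⟨ product-++ (factors (suc (suc m)) α 1) (concatMap (factors (suc (suc m)) α) (map suc (applyUpTo suc m))) ⟩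
  product (factors (suc (suc m)) α 1) * product (concatMap (factors (suc (suc m)) α) (map suc (applyUpTo suc m)))
    ≡⟨ cong₂ _*_ (cong product (map-cong row1 (range 1 (suc m)))) (cong product rest) ⟩
  rowWeight (range 1 (suc m)) s (map suc c) * weight (suc m) β ∎
  where
  open ≡-Reasoning
  α : Array
  α = (1 ∷ s) ∷ shift β
  c : List ℕ
  c = firstRow β
  row1 : ∀ k → Cnt (suc (suc m)) α 2 k C Ecnt (suc (suc m)) α 1 k
             ≡ count k (map suc c) C countMatched k s (map suc c)
  row1 k = cong₂ _C_ (Cnt-row2 (suc (suc m)) β s c≤ k) (Ecnt-row1 (suc (suc m)) β s lens c≤ k)
    where
    c≤ : length c ≤ suc (suc (suc m))
    c≤ = ≤-trans (≤-reflexive lenc) (m≤n+m (suc m) 2)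
  rest : concatMap (factors (suc (suc m)) α) (map suc (applyUpTo suc m))
       ≡ concatMap (factors (suc m) β) (map suc (upTo m))
  rest = begin
    concatMap (factors (suc (suc m)) α) (map suc (applyUpTo suc m))
      ≡⟨ concatMap-map (factors (suc (suc m)) α) suc (applyUpTo suc m) ⟩
    concatMap (λ t → factors (suc (suc m)) α (suc t)) (applyUpTo suc m)
      ≡⟨ cong (concatMap _) (map-applyUpTo (λ t → t) suc m) ⟨
    concatMap (λ t → factors (suc (suc m)) α (suc t)) (map suc (upTo m))
      ≡⟨ concatMap-map _ suc (upTo m) ⟩
    concatMap (λ t → factors (suc (suc m)) α (suc (suc t))) (upTo m)
      ≡⟨ concatMap-cong (factors-shift m β (1 ∷ s) rows) (upTo m) ⟩
    concatMap (λ t → factors (suc m) β (suc t)) (upTo m)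
      ≡⟨ concatMap-map (factors (suc m) β) suc (upTo m) ⟨
    concatMap (factors (suc m) β) (map suc (upTo m)) ∎

raiseTotal-firstRow : ∀ n β → InY n β → raiseTotal n 1 (firstRow β) ≡ 2 ^ n
raiseTotal-firstRow n β Yβ =
  trans (raiseTotal-sorted n c (nth-Linked (1 ∷ c) sorted) (nth-Linked c below-n)) (cong (2 ^_) lenc)
  where
  module Y = InY Yβ
  c : List ℕ
  c = firstRow β
  lenc : length c ≡ n
  lenc = length-firstRow β (proj₁ Y.shape) (Shape⇒RowLengths β Y.shape)
  sorted : ∀ j {v w} → nth (1 ∷ c) j ≡ just v → nth (1 ∷ c) (suc j) ≡ just w → v ≤ w
  sorted zero    refl c≡w = ≤-reflexive (sym (Y.col0 1 _ (trans (at-firstRow β 0) c≡w)))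
  sorted (suc j) c≡v  c≡w = Y.condE 1 j _ _ (trans (at-firstRow β j) c≡v) (trans (at-firstRow β (suc j)) c≡w)
  -- only the last entry of the first row can reach n, since α_{1,j} ≤ 1 + j
  below-n : ∀ j {v w} → nth c j ≡ just v → nth c (suc j) ≡ just w → v < n
  below-n j c≡v c≡w = ≤-<-trans (Y.upper 1 j _ (trans (at-firstRow β j) c≡v))
                                (≤-trans (nth-just⇒< c (suc j) c≡w) (≤-reflexive lenc))

-- Enumeration of Y_n

extensions : Array → List Array
extensions β = map (λ s → (1 ∷ s) ∷ shift β) (raises 1 (firstRow β))

arrays : ℕ → List Array
arrays zero    = [] ∷ []
arrays (suc n) = concatMap extensions (arrays n)

at-[] : ∀ i j {v} → at [] i j ≡ just v → ⊥
at-[] zero    j ()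
at-[] (suc i) j ()

InY-[] : InY 0 []
InY-[] = record
  { shape  = refl , λ ()
  ; col0   = λ i v → ⊥-elim ∘ at-[] i 0
  ; lower  = λ i j v → ⊥-elim ∘ at-[] i j
  ; upper  = λ i j v → ⊥-elim ∘ at-[] i j
  ; condNE = λ i j v w e _ → ⊥-elim (at-[] (suc i) j e)
  ; condSW = λ i j v w e _ → ⊥-elim (at-[] i (suc j) e)
  ; condE  = λ i j v w e _ → ⊥-elim (at-[] i j e)
  }

arrays-sound : ∀ n {α} → α ∈ arrays n → InY n α
arrays-sound zero    (here refl) = InY-[]
arrays-sound (suc n) α∈ with find (∈-concatMap⁻ extensions {xs = arrays n} α∈)
... | β , β∈ , α∈ext with ∈-map⁻ (λ s → (1 ∷ s) ∷ shift β) α∈ext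
...   | s , s∈ , refl = InY-cons⁺ (arrays-sound n β∈) (raises-sound (firstRow β) s∈)

arrays-complete : ∀ n {α} → InY n α → α ∈ arrays n
arrays-complete zero    {[]}    _  = here refl
arrays-complete zero    {_ ∷ _} Y  with () ← proj₁ (InY.shape Y)
arrays-complete (suc n) {α}     Y  with InY-suc⁻ α Y
... | β , s , refl = let Yβ , raise = InY-cons⁻ Y in
  ∈-concatMap⁺ extensions {xs = arrays n}
    (lose (arrays-complete n Yβ) (∈-map⁺ (λ s → (1 ∷ s) ∷ shift β) (raises-complete raise)))

Unique-concatMap : ∀ {A B : Set} (g : A → List B) {xs} → Unique xs → (∀ x → Unique (g x)) →
  (∀ {x y b} → b ∈ g x → b ∈ g y → x ≡ y) → Unique (concatMap g xs)
Unique-concatMap g {[]}     []           _        _       = []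
Unique-concatMap g {x ∷ xs} (x∉xs ∷ uxs) unique-g disjoint =
  Unique.++⁺ (unique-g x) (Unique-concatMap g uxs unique-g disjoint) not-both
  where
  not-both : ∀ {b} → b ∈ g x × b ∈ concatMap g xs → ⊥
  not-both (b∈gx , b∈rest) with find (∈-concatMap⁻ g {xs = xs} b∈rest)
  ... | y , y∈xs , b∈gy = All.lookup x∉xs y∈xs (disjoint b∈gx b∈gy)

shift-injective : ∀ {β β′} → shift β ≡ shift β′ → β ≡ β′
shift-injective = map-injective (map-injective suc-injective)

arrays-unique : ∀ n → Unique (arrays n)
arrays-unique zero    = All.[] ∷ []
arrays-unique (suc n) = Unique-concatMap extensions (arrays-unique n)
  (λ β → Unique.map⁺ (λ e → proj₂ (∷-injective (proj₁ (∷-injective e)))) (raises-unique 1 (firstRow β)))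
  same-base
  where
  same-base : ∀ {β β′ α} → α ∈ extensions β → α ∈ extensions β′ → β ≡ β′
  same-base {β} {β′} α∈ α∈′
    with ∈-map⁻ (λ s → (1 ∷ s) ∷ shift β) α∈ | ∈-map⁻ (λ s → (1 ∷ s) ∷ shift β′) α∈′
  ... | _ , _ , refl | _ , _ , e = shift-injective (proj₂ (∷-injective e))

sum-weight-extensions : ∀ n {β} → InY n β → sum (map (weight (suc n)) (extensions β)) ≡ 2 ^ n * weight n β
sum-weight-extensions n {β} Yβ = begin
  sum (map (weight (suc n)) (extensions β))
    ≡⟨ sum-map-map (weight (suc n)) (λ s → (1 ∷ s) ∷ shift β) (raises 1 c) ⟩
  sum (map (λ s → weight (suc n) ((1 ∷ s) ∷ shift β)) (raises 1 c))
    ≡⟨ sum-map-cong-∈ (raises 1 c)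
         (λ s∈ → weight-cons n β _ rows lenc (Raise-length (raises-sound c s∈))) ⟩
  sum (map (λ s → rowWeight (range 1 n) s (map suc c) * weight n β) (raises 1 c))
    ≡⟨ sum-map-*ʳ (λ s → rowWeight (range 1 n) s (map suc c)) (weight n β) (raises 1 c) ⟩
  raiseTotal n 1 c * weight n β
    ≡⟨ cong (_* weight n β) (raiseTotal-firstRow n β Yβ) ⟩
  2 ^ n * weight n β ∎
  where
  open ≡-Reasoning
  c : List ℕ
  c = firstRow β
  rows : RowLengths n β
  rows = Shape⇒RowLengths β (InY.shape Yβ)
  lenc : length c ≡ n
  lenc = length-firstRow β (proj₁ (InY.shape Yβ)) rows

sum-weight-arrays : ∀ n → sum (map (weight n) (arrays n)) ≡ 2 ^ (n C 2)
sum-weight-arrays zero    = refl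
sum-weight-arrays (suc n) = begin
  sum (map (weight (suc n)) (concatMap extensions (arrays n)))
    ≡⟨ sum-concatMap (weight (suc n)) extensions (arrays n) ⟩
  sum (map (λ β → sum (map (weight (suc n)) (extensions β))) (arrays n))
    ≡⟨ sum-map-cong-∈ (arrays n) (λ β∈ → sum-weight-extensions n (arrays-sound n β∈)) ⟩
  sum (map (λ β → 2 ^ n * weight n β) (arrays n))
    ≡⟨ sum-map-*ˡ (weight n) (2 ^ n) (arrays n) ⟩
  2 ^ n * sum (map (weight n) (arrays n))
    ≡⟨ cong (2 ^ n *_) (sum-weight-arrays n) ⟩
  2 ^ n * 2 ^ (n C 2)
    ≡⟨ ^-distribˡ-+-* 2 n (n C 2) ⟨
  2 ^ (n + n C 2)
    ≡⟨ cong (λ m → 2 ^ (m + n C 2)) (nC1≡n n) ⟨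
  2 ^ (n C 1 + n C 2)
    ≡⟨ cong (2 ^_) (nCk+nC[k+1]≡[n+1]C[k+1] n 1) ⟩
  2 ^ (suc n C 2) ∎
  where open ≡-Reasoning

corollary6p5 : (n : ℕ) → 1 ≤ n → (L : List Array) → Unique L →
    (∀ α → (α ∈ L) ⇔ InY n α) →
    2 ^ (n C 2) ≡ sum (map (weight n) L)
corollary6p5 n _ L unique-L L⇔Y = trans (sym (sum-weight-arrays n))
  (sum-map-unique (weight n) (arrays-unique n) unique-L
    (λ α → mk⇔ (λ α∈ → Equivalence.from (L⇔Y α) (arrays-sound n α∈))
               (λ α∈L → arrays-complete n (Equivalence.to (L⇔Y α) α∈L))))
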